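{- For each integer $n\geq 0$ and every $x\in\mathbb{C}$, \[ \sum_{k=0}^{\lfloor n/2\rfloor} \binom{n}{2k} C_{2(n-2k)}(x)\,\bigl(36x^2(9x^2-1)\bigr)^{k} E_{2k} = (18x^2-1)^{n}. \]
   Context: Lucas-balancing polynomials $C_n(x)$ are defined by $C_0(x)=1$, $C_1(x)=3x$, $C_n(x)=6xC_{n-1}(x)-C_{n-2}(x)$ for $n\geq 2$. Euler numbers $E_n$ are defined by $\sum_{n\geq 0}E_n\frac{z^n}{n!}=\frac{1}{\cosh z}$. -}

module Defs where

open import Level using (Level)
open import Data.Nat as ℕ using (ℕ; zero; suc)
open import Data.Nat.Combinatorics using (_C_)
open import Data.Integer as ℤ using (ℤ; +_; -[1+_])
open import Data.List using (List; []; _∷_; _++_; [_])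
open import Algebra.Bundles using (CommutativeRing)

-- Euler numbers.
-- 1/cosh z = Σ E_n z^n/n!  means  cosh z · Σ E_n z^n/n! = 1, i.e. by the
-- Cauchy product of exponential generating functions (cosh z = Σ [j even] z^j/j!):
--   Σ_{k=0}^{n} binom(n,k) [n-k even] E_k = δ_{n,0}.

isEven : ℕ → ℤ
isEven zero = + 1
isEven (suc zero) = + 0
isEven (suc (suc n)) = isEven n

eulerSum : ℕ → ℕ → List ℤ → ℤ
eulerSum n i [] = + 0
eulerSum n i (e ∷ es) = ((+ (n C i)) ℤ.* isEven (n ℕ.∸ i)) ℤ.* e ℤ.+ eulerSum n (suc i) es

nextE : ℕ → List ℤ → ℤ
nextE zero _ = + 1
nextE (suc m) es = ℤ.- eulerSum (suc m) 0 es

eulerTable : ℕ → List ℤ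
eulerTable zero = []
eulerTable (suc n) = eulerTable n ++ [ nextE n (eulerTable n) ]

E : ℕ → ℤ
E n = nextE n (eulerTable n)

module InRing {c ℓ : Level} (R : CommutativeRing c ℓ) where
  open CommutativeRing R hiding (zero)

  ιℕ : ℕ → Carrier
  ιℕ zero = 0#
  ιℕ (suc n) = 1# + ιℕ n

  ι : ℤ → Carrier
  ι (+ n) = ιℕ n
  ι -[1+ n ] = - ιℕ (suc n)

  pow : Carrier → ℕ → Carrier
  pow x zero = 1#
  pow x (suc n) = x * pow x n

  Cpol : ℕ → Carrier → Carrier
  Cpol zero x = 1#
  Cpol (suc zero) x = ι (+ 3) * x
  Cpol (suc (suc n)) x = ι (+ 6) * x * Cpol (suc n) x - Cpol n x

  sumTo : ℕ → (ℕ → Carrier) → Carrier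
  sumTo zero f = f zero
  sumTo (suc m) f = sumTo m f + f (suc m)

  lhs : ℕ → Carrier → Carrier
  lhs n x = sumTo (n ℕ./ 2) (λ k → ι (+ (n C (2 ℕ.* k))) * Cpol (2 ℕ.* (n ℕ.∸ 2 ℕ.* k)) x
                                  * pow (ι (+ 36) * x * x * (ι (+ 9) * x * x - 1#)) k
                                  * ι (E (2 ℕ.* k)))

  rhs : ℕ → Carrier → Carrier
  rhs n x = pow (ι (+ 18) * x * x - 1#) n

-- Put c = 18x² − 1 and d = 36x²(9x² − 1), so that c² − d = 1. The Lucas-balancing recurrence
-- then makes C_{2m}(x) the rational part A_m = Σ_a binom(m,a) c^(m−a) w_a of (c + √d)^m, where
-- w_a = d^(a/2) for even a and 0 for odd a. The binomial convolution
-- (f ⋆ g)_n = Σ_j binom(n,j) f_j g_(n−j), i.e. the product of exponential generating functions,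
-- is associative, and the left-hand side is (wE ⋆ (w ⋆ c^•))_n with (wE)_j = w_j E_j.
-- Since w_j w_(p−j) = w_p [p − j even], the defining relation cosh z · Σ E_n z^n/n! = 1 gives
-- (wE ⋆ w)_p = w_p Σ_j binom(p,j) [p − j even] E_j = w_p [p = 0], so the sum collapses to c^n.
module Submission where

open import Defs
open import Level using (Level)
open import Function using (_∘_)
open import Data.Nat as ℕ using (ℕ; zero; suc; _!; _≤_; z≤n; s≤s)
import Data.Nat.Properties as ℕP
open import Data.Nat.Combinatorics using (_C_; nCn≡1; k![n∸k]!∣n!; nCk+nC[k+1]≡[n+1]C[k+1])
open import Data.Nat.Combinatorics.Specification using (nCk≡n!/k![n-k]!; k>n⇒nCk≡0)
open import Data.Nat.DivMod using (m/n*n≡m; m≡m%n+[m/n]*n; m%n<n)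
open import Data.Nat.Solver using (module +-*-Solver)
open import Data.Integer as ℤ using (ℤ; +_; -[1+_])
import Data.Integer.Properties as ℤP
open import Data.List using ([]; _∷_; _++_; [_]; length)
import Data.List.Properties as LP
open import Data.Maybe using (Maybe; nothing; just)
open import Data.Product using (_×_; _,_; proj₁; proj₂)
open import Data.Sum using (_⊎_; inj₁; inj₂)
open import Relation.Binary.PropositionalEquality as P using (_≡_)
open import Relation.Nullary using (yes; no)
open import Algebra.Bundles using (CommutativeRing)
open import Algebra.Solver.Ring.AlmostCommutativeRing using (fromCommutativeRing; _-Raw-AlmostCommutative⟶_)
import Algebra.Solver.Ring as RingSolver

nCk*k!*[n∸k]!≡n! : ∀ {n k} → k ≤ n → (n C k) ℕ.* (k ! ℕ.* (n ℕ.∸ k) !) ≡ n !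
nCk*k!*[n∸k]!≡n! {n} {k} k≤n =
  P.trans (P.cong (ℕ._* (k ! ℕ.* (n ℕ.∸ k) !)) (nCk≡n!/k![n-k]! k≤n))
          (m/n*n≡m {{ℕP._!*_!≢0 k (n ℕ.∸ k)}} (k![n∸k]!∣n! k≤n))

[m+n]Cm*m!*n!≡[m+n]! : ∀ m n → ((m ℕ.+ n) C m) ℕ.* (m ! ℕ.* n !) ≡ (m ℕ.+ n) !
[m+n]Cm*m!*n!≡[m+n]! m n =
  P.subst (λ t → ((m ℕ.+ n) C m) ℕ.* (m ! ℕ.* t !) ≡ (m ℕ.+ n) !)
          (ℕP.m+n∸m≡n m n) (nCk*k!*[n∸k]!≡n! (ℕP.m≤m+n m n))

trinomial : ∀ j q r →
  ((j ℕ.+ (q ℕ.+ r)) C j) ℕ.* ((q ℕ.+ r) C q) ≡ ((j ℕ.+ (q ℕ.+ r)) C (j ℕ.+ q)) ℕ.* ((j ℕ.+ q) C j)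
trinomial j q r =
  ℕP.*-cancelʳ-≡ _ _ (j ! ℕ.* (q ! ℕ.* r !)) {{ℕP.m*n≢0 _ _ {{ℕP._!≢0 j}} {{ℕP._!*_!≢0 q r}}}}
    (P.trans viaJ (P.sym viaJ+Q))
  where
  open P.≡-Reasoning
  open +-*-Solver
  N = j ℕ.+ (q ℕ.+ r)

  viaJ : (N C j) ℕ.* ((q ℕ.+ r) C q) ℕ.* (j ! ℕ.* (q ! ℕ.* r !)) ≡ N !
  viaJ = begin
    (N C j) ℕ.* ((q ℕ.+ r) C q) ℕ.* (j ! ℕ.* (q ! ℕ.* r !))
      ≡⟨ solve 5 (λ a b x y z → a :* b :* (x :* (y :* z)) := a :* (x :* (b :* (y :* z)))) P.refl
               (N C j) ((q ℕ.+ r) C q) (j !) (q !) (r !) ⟩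
    (N C j) ℕ.* (j ! ℕ.* (((q ℕ.+ r) C q) ℕ.* (q ! ℕ.* r !)))
      ≡⟨ P.cong (λ t → (N C j) ℕ.* (j ! ℕ.* t)) ([m+n]Cm*m!*n!≡[m+n]! q r) ⟩
    (N C j) ℕ.* (j ! ℕ.* (q ℕ.+ r) !)
      ≡⟨ [m+n]Cm*m!*n!≡[m+n]! j (q ℕ.+ r) ⟩
    N ! ∎

  viaJ+Q : (N C (j ℕ.+ q)) ℕ.* ((j ℕ.+ q) C j) ℕ.* (j ! ℕ.* (q ! ℕ.* r !)) ≡ N !
  viaJ+Q = begin
    (N C (j ℕ.+ q)) ℕ.* ((j ℕ.+ q) C j) ℕ.* (j ! ℕ.* (q ! ℕ.* r !))
      ≡⟨ solve 5 (λ a b x y z → a :* b :* (x :* (y :* z)) := a :* ((b :* (x :* y)) :* z)) P.refl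
               (N C (j ℕ.+ q)) ((j ℕ.+ q) C j) (j !) (q !) (r !) ⟩
    (N C (j ℕ.+ q)) ℕ.* ((((j ℕ.+ q) C j) ℕ.* (j ! ℕ.* q !)) ℕ.* r !)
      ≡⟨ P.cong (λ t → (N C (j ℕ.+ q)) ℕ.* (t ℕ.* r !)) ([m+n]Cm*m!*n!≡[m+n]! j q) ⟩
    (N C (j ℕ.+ q)) ℕ.* ((j ℕ.+ q) ! ℕ.* r !)
      ≡⟨ P.cong (λ t → (t C (j ℕ.+ q)) ℕ.* ((j ℕ.+ q) ! ℕ.* r !)) (ℕP.+-assoc j q r) ⟨
    ((j ℕ.+ q ℕ.+ r) C (j ℕ.+ q)) ℕ.* ((j ℕ.+ q) ! ℕ.* r !)
      ≡⟨ [m+n]Cm*m!*n!≡[m+n]! (j ℕ.+ q) r ⟩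
    (j ℕ.+ q ℕ.+ r) !
      ≡⟨ P.cong _! (ℕP.+-assoc j q r) ⟩
    N ! ∎

nCj*[n∸j]C[p∸j]≡nCp*pCj : ∀ {n p j} → j ≤ p → p ≤ n →
  (n C j) ℕ.* ((n ℕ.∸ j) C (p ℕ.∸ j)) ≡ (n C p) ℕ.* (p C j)
nCj*[n∸j]C[p∸j]≡nCp*pCj {j = j} j≤p p≤n
  with q , P.refl ← ℕP.m≤n⇒∃[o]m+o≡n j≤p
  with r , P.refl ← ℕP.m≤n⇒∃[o]m+o≡n p≤n = begin
    ((j ℕ.+ q ℕ.+ r) C j) ℕ.* ((j ℕ.+ q ℕ.+ r ℕ.∸ j) C (j ℕ.+ q ℕ.∸ j))
      ≡⟨ P.cong₂ (λ m k → (m C j) ℕ.* ((m ℕ.∸ j) C k)) (ℕP.+-assoc j q r) (ℕP.m+n∸m≡n j q) ⟩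
    ((j ℕ.+ (q ℕ.+ r)) C j) ℕ.* ((j ℕ.+ (q ℕ.+ r) ℕ.∸ j) C q)
      ≡⟨ P.cong (λ m → ((j ℕ.+ (q ℕ.+ r)) C j) ℕ.* (m C q)) (ℕP.m+n∸m≡n j (q ℕ.+ r)) ⟩
    ((j ℕ.+ (q ℕ.+ r)) C j) ℕ.* ((q ℕ.+ r) C q)
      ≡⟨ trinomial j q r ⟩
    ((j ℕ.+ (q ℕ.+ r)) C (j ℕ.+ q)) ℕ.* ((j ℕ.+ q) C j)
      ≡⟨ P.cong (λ m → (m C (j ℕ.+ q)) ℕ.* ((j ℕ.+ q) C j)) (ℕP.+-assoc j q r) ⟨
    ((j ℕ.+ q ℕ.+ r) C (j ℕ.+ q)) ℕ.* ((j ℕ.+ q) C j) ∎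
  where open P.≡-Reasoning

parity : ∀ n → n ≡ 2 ℕ.* (n ℕ./ 2) ⊎ n ≡ suc (2 ℕ.* (n ℕ./ 2))
parity n with n ℕ.% 2 | m%n<n n 2 | m≡m%n+[m/n]*n n 2
... | zero        | _              | n≡ = inj₁ (P.trans n≡ (ℕP.*-comm (n ℕ./ 2) 2))
... | suc zero    | _              | n≡ = inj₂ (P.trans n≡ (P.cong suc (ℕP.*-comm (n ℕ./ 2) 2)))
... | suc (suc _) | s≤s (s≤s ()) | _

open InRing ℤP.+-*-commutativeRing using () renaming (sumTo to ∑ℤ)

isZero : ℕ → ℤ
isZero zero = + 1
isZero (suc _) = + 0

coshWeight : ℕ → ℕ → ℤ
coshWeight p k = + (p C k) ℤ.* isEven (p ℕ.∸ k)

eulerTerm : ℕ → ℕ → ℤ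
eulerTerm p j = coshWeight p j ℤ.* E j

eulerSum-∷ʳ : ∀ p i es e →
  eulerSum p i (es ++ [ e ]) ≡ eulerSum p i es ℤ.+ coshWeight p (i ℕ.+ length es) ℤ.* e
eulerSum-∷ʳ p i [] e = begin
    coshWeight p i ℤ.* e ℤ.+ + 0         ≡⟨ ℤP.+-identityʳ _ ⟩
    coshWeight p i ℤ.* e                 ≡⟨ P.cong (λ k → coshWeight p k ℤ.* e) (ℕP.+-identityʳ i) ⟨
    coshWeight p (i ℕ.+ 0) ℤ.* e         ≡⟨ ℤP.+-identityˡ _ ⟨
    + 0 ℤ.+ coshWeight p (i ℕ.+ 0) ℤ.* e ∎
  where open P.≡-Reasoning
eulerSum-∷ʳ p i (e′ ∷ es) e = begin
    t ℤ.+ eulerSum p (suc i) (es ++ [ e ])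
      ≡⟨ P.cong (λ s → t ℤ.+ s) (eulerSum-∷ʳ p (suc i) es e) ⟩
    t ℤ.+ (eulerSum p (suc i) es ℤ.+ coshWeight p (suc i ℕ.+ length es) ℤ.* e)
      ≡⟨ ℤP.+-assoc t _ _ ⟨
    t ℤ.+ eulerSum p (suc i) es ℤ.+ coshWeight p (suc i ℕ.+ length es) ℤ.* e
      ≡⟨ P.cong (λ k → t ℤ.+ eulerSum p (suc i) es ℤ.+ coshWeight p k ℤ.* e) (ℕP.+-suc i (length es)) ⟨
    t ℤ.+ eulerSum p (suc i) es ℤ.+ coshWeight p (i ℕ.+ suc (length es)) ℤ.* e ∎
  where
  open P.≡-Reasoning
  t = coshWeight p i ℤ.* e′

length-eulerTable : ∀ k → length (eulerTable k) ≡ k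
length-eulerTable zero = P.refl
length-eulerTable (suc k) =
  P.trans (LP.length-++ (eulerTable k)) (P.trans (ℕP.+-comm _ 1) (P.cong suc (length-eulerTable k)))

eulerSum-eulerTable : ∀ p k → eulerSum p 0 (eulerTable (suc k)) ≡ ∑ℤ k (eulerTerm p)
eulerSum-eulerTable p zero = ℤP.+-identityʳ _
eulerSum-eulerTable p (suc k) =
  P.trans (eulerSum-∷ʳ p 0 (eulerTable (suc k)) (E (suc k)))
          (P.cong₂ ℤ._+_ (eulerSum-eulerTable p k) (P.cong (λ i → coshWeight p i ℤ.* E (suc k)) (length-eulerTable (suc k))))

euler-recurrence : ∀ p → ∑ℤ p (eulerTerm p) ≡ isZero p
euler-recurrence zero = P.refl
euler-recurrence p@(suc m) = begin
    ∑ℤ m (eulerTerm p) ℤ.+ eulerTerm p p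
      ≡⟨ P.cong (λ s → ∑ℤ m (eulerTerm p) ℤ.+ s) lastTerm ⟩
    ∑ℤ m (eulerTerm p) ℤ.- ∑ℤ m (eulerTerm p)
      ≡⟨ ℤP.+-inverseʳ (∑ℤ m (eulerTerm p)) ⟩
    + 0 ∎
  where
  open P.≡-Reasoning
  lastTerm : eulerTerm p p ≡ ℤ.- ∑ℤ m (eulerTerm p)
  lastTerm = begin
    + (p C p) ℤ.* isEven (p ℕ.∸ p) ℤ.* E p
      ≡⟨ P.cong₂ (λ a b → + a ℤ.* isEven b ℤ.* E p) (nCn≡1 p) (ℕP.n∸n≡0 p) ⟩
    + 1 ℤ.* + 1 ℤ.* E p
      ≡⟨ ℤP.*-identityˡ (E p) ⟩
    ℤ.- eulerSum p 0 (eulerTable p)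
      ≡⟨ P.cong ℤ.-_ (eulerSum-eulerTable p m) ⟩
    ℤ.- ∑ℤ m (eulerTerm p) ∎

module Cast {a ℓ} (R : CommutativeRing a ℓ) where
  open CommutativeRing R hiding (zero)
  open InRing R
  open import Algebra.Properties.Ring ring using (-‿distribˡ-*; -‿involutive; -‿+-comm; -0#≈0#)
  open import Algebra.Properties.CommutativeSemigroup +-commutativeSemigroup using (interchange)
  open import Relation.Binary.Reasoning.Setoid setoid


  ιℕ-+ : ∀ m n → ιℕ (m ℕ.+ n) ≈ ιℕ m + ιℕ n
  ιℕ-+ zero n = sym (+-identityˡ _)
  ιℕ-+ (suc m) n = trans (+-congˡ (ιℕ-+ m n)) (sym (+-assoc _ _ _))

  ιℕ-* : ∀ m n → ιℕ (m ℕ.* n) ≈ ιℕ m * ιℕ n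
  ιℕ-* zero n = sym (zeroˡ _)
  ιℕ-* (suc m) n = begin
    ιℕ (n ℕ.+ m ℕ.* n)      ≈⟨ ιℕ-+ n (m ℕ.* n) ⟩
    ιℕ n + ιℕ (m ℕ.* n)     ≈⟨ +-cong (sym (*-identityˡ _)) (ιℕ-* m n) ⟩
    1# * ιℕ n + ιℕ m * ιℕ n ≈⟨ distribʳ _ _ _ ⟨
    (1# + ιℕ m) * ιℕ n      ∎

  ι-⊖ : ∀ m n → ι (m ℤ.⊖ n) ≈ ιℕ m - ιℕ n
  ι-⊖ m zero = sym (trans (+-congˡ -0#≈0#) (+-identityʳ _))
  ι-⊖ zero (suc n) = sym (+-identityˡ _)
  ι-⊖ (suc m) (suc n) = begin
    ι (suc m ℤ.⊖ suc n)               ≡⟨ P.cong ι (ℤP.[1+m]⊖[1+n]≡m⊖n m n) ⟩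
    ι (m ℤ.⊖ n)                       ≈⟨ ι-⊖ m n ⟩
    ιℕ m - ιℕ n                       ≈⟨ +-identityˡ _ ⟨
    0# + (ιℕ m - ιℕ n)                ≈⟨ +-congʳ (-‿inverseʳ 1#) ⟨
    (1# - 1#) + (ιℕ m - ιℕ n)         ≈⟨ interchange 1# (- 1#) (ιℕ m) (- ιℕ n) ⟩
    (1# + ιℕ m) + (- 1# + - ιℕ n)     ≈⟨ +-congˡ (-‿+-comm 1# (ιℕ n)) ⟩
    (1# + ιℕ m) - (1# + ιℕ n)         ∎

  ι-+ : ∀ i j → ι (i ℤ.+ j) ≈ ι i + ι j
  ι-+ (+ m) (+ n) = ιℕ-+ m n
  ι-+ (+ m) -[1+ n ] = ι-⊖ m (suc n)
  ι-+ -[1+ m ] (+ n) = trans (ι-⊖ n (suc m)) (+-comm _ _)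
  ι-+ -[1+ m ] -[1+ n ] = begin
    - ιℕ (suc (suc (m ℕ.+ n)))      ≡⟨ P.cong (λ k → - ιℕ (suc k)) (ℕP.+-suc m n) ⟨
    - ιℕ (suc m ℕ.+ suc n)          ≈⟨ -‿cong (ιℕ-+ (suc m) (suc n)) ⟩
    - (ιℕ (suc m) + ιℕ (suc n))     ≈⟨ -‿+-comm _ _ ⟨
    - ιℕ (suc m) + - ιℕ (suc n)     ∎

  ι-neg : ∀ i → ι (ℤ.- i) ≈ - ι i
  ι-neg (+ zero) = sym -0#≈0#
  ι-neg (+ suc n) = refl
  ι-neg -[1+ n ] = sym (-‿involutive _)

  ι-*-+ : ∀ m j → ι (+ m ℤ.* j) ≈ ιℕ m * ι j
  ι-*-+ zero j = begin
    ι (+ 0 ℤ.* j) ≡⟨ P.cong ι (ℤP.*-zeroˡ j) ⟩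
    0#            ≈⟨ zeroˡ _ ⟨
    0# * ι j      ∎
  ι-*-+ (suc m) j = begin
    ι (+ suc m ℤ.* j)      ≡⟨ P.cong ι (ℤP.suc-* (+ m) j) ⟩
    ι (j ℤ.+ + m ℤ.* j)    ≈⟨ ι-+ j _ ⟩
    ι j + ι (+ m ℤ.* j)    ≈⟨ +-cong (sym (*-identityˡ _)) (ι-*-+ m j) ⟩
    1# * ι j + ιℕ m * ι j  ≈⟨ distribʳ _ _ _ ⟨
    (1# + ιℕ m) * ι j      ∎

  ι-* : ∀ i j → ι (i ℤ.* j) ≈ ι i * ι j
  ι-* (+ m) j = ι-*-+ m j
  ι-* -[1+ m ] j = begin
    ι (-[1+ m ] ℤ.* j)        ≡⟨ P.cong ι (ℤP.neg-distribˡ-* (+ suc m) j) ⟨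
    ι (ℤ.- (+ suc m ℤ.* j))   ≈⟨ ι-neg (+ suc m ℤ.* j) ⟩
    - ι (+ suc m ℤ.* j)       ≈⟨ -‿cong (ι-*-+ (suc m) j) ⟩
    - (ιℕ (suc m) * ι j)      ≈⟨ -‿distribˡ-* _ _ ⟩
    - ιℕ (suc m) * ι j        ∎

  -- ι with 0 and 1 sent to 0# and 1# on the nose, so that the solver's constants 0 and 1 read as 0# and 1#.
  ι′ : ℤ → Carrier
  ι′ (+ 0) = 0#
  ι′ (+ 1) = 1#
  ι′ i = ι i

  ι′≈ι : ∀ i → ι′ i ≈ ι i
  ι′≈ι (+ 0) = refl
  ι′≈ι (+ 1) = sym (+-identityʳ 1#)
  ι′≈ι (+ suc (suc n)) = refl
  ι′≈ι -[1+ n ] = refl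

  ι′-homomorphism : CommutativeRing.rawRing ℤP.+-*-commutativeRing -Raw-AlmostCommutative⟶ fromCommutativeRing R
  ι′-homomorphism = record
    { ⟦_⟧    = ι′
    ; +-homo = λ i j → homo (i ℤ.+ j) (trans (ι-+ i j) (sym (+-cong (ι′≈ι i) (ι′≈ι j))))
    ; *-homo = λ i j → homo (i ℤ.* j) (trans (ι-* i j) (sym (*-cong (ι′≈ι i) (ι′≈ι j))))
    ; -‿homo = λ i → homo (ℤ.- i) (trans (ι-neg i) (sym (-‿cong (ι′≈ι i))))
    ; 0-homo = refl
    ; 1-homo = refl
    }
    where
    homo : ∀ i {y} → ι i ≈ y → ι′ i ≈ y
    homo i = trans (ι′≈ι i)

  ℤ≟ : ∀ i j → Maybe (ι′ i ≈ ι′ j)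
  ℤ≟ i j with i ℤ.≟ j
  ... | yes P.refl = just refl
  ... | no _ = nothing

  module ℤ-Solver = RingSolver (CommutativeRing.rawRing ℤP.+-*-commutativeRing) (fromCommutativeRing R) ι′-homomorphism ℤ≟

  ι-sumTo : ∀ m f → ι (∑ℤ m f) ≈ sumTo m (ι ∘ f)
  ι-sumTo zero f = refl
  ι-sumTo (suc m) f = trans (ι-+ (∑ℤ m f) (f (suc m))) (+-congʳ (ι-sumTo m f))

module Sums {a ℓ} (R : CommutativeRing a ℓ) where
  open CommutativeRing R hiding (zero)
  open InRing R
  open import Algebra.Properties.CommutativeSemigroup +-commutativeSemigroup using (interchange)
  open import Relation.Binary.Reasoning.Setoid setoid

  sumTo-cong : ∀ m {f g} → (∀ j → j ≤ m → f j ≈ g j) → sumTo m f ≈ sumTo m g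
  sumTo-cong zero f≈g = f≈g 0 z≤n
  sumTo-cong (suc m) f≈g = +-cong (sumTo-cong m (λ j j≤m → f≈g j (ℕP.m≤n⇒m≤1+n j≤m))) (f≈g (suc m) ℕP.≤-refl)

  sumTo-+ : ∀ m f g → sumTo m (λ j → f j + g j) ≈ sumTo m f + sumTo m g
  sumTo-+ zero f g = refl
  sumTo-+ (suc m) f g = trans (+-congʳ (sumTo-+ m f g)) (interchange _ _ _ _)

  sumTo-*ˡ : ∀ m k f → sumTo m (λ j → k * f j) ≈ k * sumTo m f
  sumTo-*ˡ zero k f = refl
  sumTo-*ˡ (suc m) k f = trans (+-congʳ (sumTo-*ˡ m k f)) (sym (distribˡ k _ _))

  sumTo-*ʳ : ∀ m k f → sumTo m (λ j → f j * k) ≈ sumTo m f * k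
  sumTo-*ʳ zero k f = refl
  sumTo-*ʳ (suc m) k f = trans (+-congʳ (sumTo-*ʳ m k f)) (sym (distribʳ k _ _))

  sumTo-sucˡ : ∀ m f → sumTo (suc m) f ≈ f 0 + sumTo m (f ∘ suc)
  sumTo-sucˡ zero f = refl
  sumTo-sucˡ (suc m) f = trans (+-congʳ (sumTo-sucˡ m f)) (+-assoc _ _ _)

  sumTo-0 : ∀ m f → (∀ j → j ≤ m → f j ≈ 0#) → sumTo m f ≈ 0#
  sumTo-0 zero f f≈0 = f≈0 0 z≤n
  sumTo-0 (suc m) f f≈0 =
    trans (+-cong (sumTo-0 m f (λ j j≤m → f≈0 j (ℕP.m≤n⇒m≤1+n j≤m))) (f≈0 (suc m) ℕP.≤-refl)) (+-identityˡ 0#)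

  sumTo-triangle : ∀ n (h : ℕ → ℕ → Carrier) →
    sumTo n (λ j → sumTo (n ℕ.∸ j) (h j)) ≈ sumTo n (λ p → sumTo p (λ j → h j (p ℕ.∸ j)))
  sumTo-triangle zero h = refl
  sumTo-triangle (suc n) h = begin
    sumTo n (λ j → sumTo (suc n ℕ.∸ j) (h j)) + sumTo (n ℕ.∸ n) (h (suc n))
      ≈⟨ +-cong (sumTo-cong n (λ j j≤n → reflexive (P.cong (λ t → sumTo t (h j)) (ℕP.+-∸-assoc 1 j≤n))))
                (reflexive (P.cong (λ t → sumTo t (h (suc n))) (ℕP.n∸n≡0 n))) ⟩
    sumTo n (λ j → sumTo (n ℕ.∸ j) (h j) + h j (suc (n ℕ.∸ j))) + h (suc n) 0
      ≈⟨ +-congʳ (sumTo-+ n _ _) ⟩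
    sumTo n (λ j → sumTo (n ℕ.∸ j) (h j)) + sumTo n (λ j → h j (suc (n ℕ.∸ j))) + h (suc n) 0
      ≈⟨ +-assoc _ _ _ ⟩
    sumTo n (λ j → sumTo (n ℕ.∸ j) (h j)) + (sumTo n (λ j → h j (suc (n ℕ.∸ j))) + h (suc n) 0)
      ≈⟨ +-cong (sumTo-triangle n h)
                (+-cong (sumTo-cong n (λ j j≤n → reflexive (P.cong (h j) (P.sym (ℕP.+-∸-assoc 1 j≤n)))))
                        (reflexive (P.cong (h (suc n)) (P.sym (ℕP.n∸n≡0 n))))) ⟩
    sumTo n (λ p → sumTo p (λ j → h j (p ℕ.∸ j))) + sumTo (suc n) (λ j → h j (suc n ℕ.∸ j)) ∎

  module _ (f : ℕ → Carrier) (f-odd : ∀ k → f (suc (2 ℕ.* k)) ≈ 0#) where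

    sumTo-2* : ∀ m → sumTo (2 ℕ.* m) f ≈ sumTo m (λ k → f (2 ℕ.* k))
    sumTo-2* zero = refl
    sumTo-2* (suc m) = begin
      sumTo (2 ℕ.* suc m) f
        ≡⟨ P.cong (λ t → sumTo t f) (ℕP.*-suc 2 m) ⟩
      sumTo (2 ℕ.* m) f + f (suc (2 ℕ.* m)) + f (2 ℕ.+ 2 ℕ.* m)
        ≈⟨ +-congʳ (trans (+-cong (sumTo-2* m) (f-odd m)) (+-identityʳ _)) ⟩
      sumTo m (λ k → f (2 ℕ.* k)) + f (2 ℕ.+ 2 ℕ.* m)
        ≡⟨ P.cong (λ t → sumTo m (λ k → f (2 ℕ.* k)) + f t) (ℕP.*-suc 2 m) ⟨
      sumTo (suc m) (λ k → f (2 ℕ.* k)) ∎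

    sumTo-evens : ∀ n → sumTo (n ℕ./ 2) (λ k → f (2 ℕ.* k)) ≈ sumTo n f
    sumTo-evens n with parity n
    ... | inj₁ n≡2m = sym (trans (reflexive (P.cong (λ t → sumTo t f) n≡2m)) (sumTo-2* (n ℕ./ 2)))
    ... | inj₂ n≡1+2m = sym (trans (reflexive (P.cong (λ t → sumTo t f) n≡1+2m))
                                   (trans (+-cong (sumTo-2* (n ℕ./ 2)) (f-odd (n ℕ./ 2))) (+-identityʳ _)))

module Convolution {a ℓ} (R : CommutativeRing a ℓ) where
  open CommutativeRing R hiding (zero)
  open InRing R
  open Cast R
  open Sums R
  open import Algebra.Properties.CommutativeSemigroup +-commutativeSemigroup using (x∙yz≈y∙xz)
  open ℤ-Solver using (solve; _:=_; _:*_)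
  open import Relation.Binary.Reasoning.Setoid setoid

  infixl 7 _⋆_
  _⋆_ : (ℕ → Carrier) → (ℕ → Carrier) → ℕ → Carrier
  (f ⋆ g) n = sumTo n (λ j → ιℕ (n C j) * f j * g (n ℕ.∸ j))

  ⋆-congˡ : ∀ {f f′} g → (∀ j → f j ≈ f′ j) → ∀ n → (f ⋆ g) n ≈ (f′ ⋆ g) n
  ⋆-congˡ g f≈f′ n = sumTo-cong n (λ j _ → *-congʳ (*-congˡ (f≈f′ j)))

  ⋆-*ˡ : ∀ k f g n → ((λ j → k * f j) ⋆ g) n ≈ k * (f ⋆ g) n
  ⋆-*ˡ k f g n = trans (sumTo-cong n (λ j _ → regroup _ k (f j) _)) (sumTo-*ˡ n k _)
    where
    regroup : ∀ b k u v → b * (k * u) * v ≈ k * (b * u * v)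
    regroup = solve 4 (λ b k u v → b :* (k :* u) :* v := k :* (b :* u :* v)) refl

  ⋆-*ʳ : ∀ k f g n → (f ⋆ (λ j → k * g j)) n ≈ k * (f ⋆ g) n
  ⋆-*ʳ k f g n = trans (sumTo-cong n (λ j _ → regroup _ (f j) k _)) (sumTo-*ˡ n k _)
    where
    regroup : ∀ b u k v → b * u * (k * v) ≈ k * (b * u * v)
    regroup = solve 4 (λ b u k v → b :* u :* (k :* v) := k :* (b :* u :* v)) refl

  ⋆-headˡ : ∀ (f g : ℕ → Carrier) n → ιℕ (n C 0) * f 0 * g (n ℕ.∸ 0) ≈ f 0 * g n
  ⋆-headˡ f g n = *-congʳ (trans (*-congʳ (+-identityʳ 1#)) (*-identityˡ (f 0)))

  ⋆-concentratedˡ : ∀ (f g : ℕ → Carrier) → (∀ j → f (suc j) ≈ 0#) → ∀ n → (f ⋆ g) n ≈ f 0 * g n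
  ⋆-concentratedˡ f g f≈0 zero = ⋆-headˡ f g 0
  ⋆-concentratedˡ f g f≈0 (suc m) = begin
    (f ⋆ g) (suc m)
      ≈⟨ sumTo-sucˡ m _ ⟩
    ιℕ 1 * f 0 * g (suc m) + sumTo m (λ j → ιℕ (suc m C suc j) * f (suc j) * g (m ℕ.∸ j))
      ≈⟨ +-cong (⋆-headˡ f g (suc m)) (sumTo-0 m _ (λ j _ → vanish j)) ⟩
    f 0 * g (suc m) + 0#
      ≈⟨ +-identityʳ _ ⟩
    f 0 * g (suc m) ∎
    where
    vanish : ∀ j → ιℕ (suc m C suc j) * f (suc j) * g (m ℕ.∸ j) ≈ 0#
    vanish j = trans (*-congʳ (trans (*-congˡ (f≈0 j)) (zeroʳ _))) (zeroˡ _)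

  -- When a ≥ m the indices m ∸ a and suc (m ∸ suc a) differ (truncated subtraction), but then m C suc a = 0.
  ιC-suc-∸ : ∀ m a u (φ : ℕ → Carrier) →
    ιℕ (m C suc a) * u * φ (suc (m ℕ.∸ suc a)) ≈ ιℕ (m C suc a) * u * φ (m ℕ.∸ a)
  ιC-suc-∸ m a u φ with a ℕP.<? m
  ... | yes a<m = reflexive (P.cong (λ i → ιℕ (m C suc a) * u * φ i) (P.sym (ℕP.+-∸-assoc 1 a<m)))
  ... | no a≮m rewrite k>n⇒nCk≡0 (s≤s (ℕP.≮⇒≥ a≮m)) = trans (vanish _) (sym (vanish _))
    where
    vanish : ∀ v → 0# * u * v ≈ 0#
    vanish v = trans (*-congʳ (zeroˡ u)) (zeroˡ v)

  -- Leibniz rule for exponential generating functions: (f g)′ = f′ g + f g′.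
  ⋆-suc : ∀ f g m → (f ⋆ g) (suc m) ≈ ((f ∘ suc) ⋆ g) m + (f ⋆ (g ∘ suc)) m
  ⋆-suc f g m = begin
    (f ⋆ g) (suc m)
      ≈⟨ sumTo-sucˡ m _ ⟩
    head + sumTo m (λ a → ιℕ (suc m C suc a) * f (suc a) * g (m ℕ.∸ a))
      ≈⟨ +-congˡ (trans (sumTo-cong m (λ a _ → pascal a)) (sumTo-+ m _ _)) ⟩
    head + (((f ∘ suc) ⋆ g) m + sumTo m Q)
      ≈⟨ x∙yz≈y∙xz head _ _ ⟩
    ((f ∘ suc) ⋆ g) m + (head + sumTo m Q)
      ≈⟨ +-congˡ shifted ⟨
    ((f ∘ suc) ⋆ g) m + (f ⋆ (g ∘ suc)) m ∎
    where
    head = ιℕ (m C 0) * f 0 * g (suc m)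

    Q : ℕ → Carrier
    Q a = ιℕ (m C suc a) * f (suc a) * g (m ℕ.∸ a)

    pascal : ∀ a → ιℕ (suc m C suc a) * f (suc a) * g (m ℕ.∸ a)
                   ≈ ιℕ (m C a) * f (suc a) * g (m ℕ.∸ a) + Q a
    pascal a = begin
      ιℕ (suc m C suc a) * f (suc a) * g (m ℕ.∸ a)
        ≡⟨ P.cong (λ k → ιℕ k * f (suc a) * g (m ℕ.∸ a)) (nCk+nC[k+1]≡[n+1]C[k+1] m a) ⟨
      ιℕ (m C a ℕ.+ m C suc a) * f (suc a) * g (m ℕ.∸ a)
        ≈⟨ *-congʳ (trans (*-congʳ (ιℕ-+ (m C a) _)) (distribʳ _ _ _)) ⟩
      (ιℕ (m C a) * f (suc a) + ιℕ (m C suc a) * f (suc a)) * g (m ℕ.∸ a)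
        ≈⟨ distribʳ _ _ _ ⟩
      ιℕ (m C a) * f (suc a) * g (m ℕ.∸ a) + Q a ∎

    shifted : (f ⋆ (g ∘ suc)) m ≈ head + sumTo m Q
    shifted = begin
      (f ⋆ (g ∘ suc)) m
        ≈⟨ +-identityʳ _ ⟨
      (f ⋆ (g ∘ suc)) m + 0#
        ≈⟨ +-congˡ (trans (*-congʳ (trans (*-congʳ (reflexive (P.cong ιℕ (k>n⇒nCk≡0 (ℕP.n<1+n m)))))
                                          (zeroˡ _))) (zeroˡ _)) ⟨
      sumTo (suc m) (λ j → ιℕ (m C j) * f j * g (suc (m ℕ.∸ j)))
        ≈⟨ sumTo-sucˡ m _ ⟩
      head + sumTo m (λ a → ιℕ (m C suc a) * f (suc a) * g (suc (m ℕ.∸ suc a)))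
        ≈⟨ +-congˡ (sumTo-cong m (λ a _ → ιC-suc-∸ m a (f (suc a)) g)) ⟩
      head + sumTo m Q ∎

  ⋆-assoc : ∀ f g h n → ((f ⋆ g) ⋆ h) n ≈ (f ⋆ (g ⋆ h)) n
  ⋆-assoc f g h n = begin
    ((f ⋆ g) ⋆ h) n
      ≈⟨ sumTo-cong n (λ p p≤n → expand p p≤n) ⟩
    sumTo n (λ p → sumTo p (λ j → T j (p ℕ.∸ j)))
      ≈⟨ sumTo-triangle n T ⟨
    sumTo n (λ j → sumTo (n ℕ.∸ j) (T j))
      ≈⟨ sumTo-cong n (λ j _ → sumTo-*ˡ (n ℕ.∸ j) _ _) ⟩
    (f ⋆ (g ⋆ h)) n ∎
    where
    T : ℕ → ℕ → Carrier
    T j a = ιℕ (n C j) * f j * (ιℕ ((n ℕ.∸ j) C a) * g a * h (n ℕ.∸ j ℕ.∸ a))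

    regroup : ∀ {j p} → j ≤ p → p ≤ n →
      ιℕ (n C p) * (ιℕ (p C j) * f j * g (p ℕ.∸ j)) * h (n ℕ.∸ p) ≈ T j (p ℕ.∸ j)
    regroup {j} {p} j≤p p≤n = begin
      ιℕ (n C p) * (ιℕ (p C j) * f j * g (p ℕ.∸ j)) * h (n ℕ.∸ p)
        ≈⟨ solve 5 (λ b b′ u v w → b :* (b′ :* u :* v) :* w := b :* b′ :* (u :* (v :* w))) refl _ _ _ _ _ ⟩
      ιℕ (n C p) * ιℕ (p C j) * (f j * (g (p ℕ.∸ j) * h (n ℕ.∸ p)))
        ≈⟨ *-congʳ (trans (sym (ιℕ-* (n C p) _)) (trans (reflexive (P.cong ιℕ (P.sym binomials))) (ιℕ-* (n C j) _))) ⟩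
      ιℕ (n C j) * ιℕ ((n ℕ.∸ j) C (p ℕ.∸ j)) * (f j * (g (p ℕ.∸ j) * h (n ℕ.∸ p)))
        ≡⟨ P.cong (λ i → ιℕ (n C j) * ιℕ ((n ℕ.∸ j) C (p ℕ.∸ j)) * (f j * (g (p ℕ.∸ j) * h i))) indices ⟨
      ιℕ (n C j) * ιℕ ((n ℕ.∸ j) C (p ℕ.∸ j)) * (f j * (g (p ℕ.∸ j) * h (n ℕ.∸ j ℕ.∸ (p ℕ.∸ j))))
        ≈⟨ solve 5 (λ b b′ u v w → b :* b′ :* (u :* (v :* w)) := b :* u :* (b′ :* v :* w)) refl _ _ _ _ _ ⟩
      T j (p ℕ.∸ j) ∎
      where
      binomials = nCj*[n∸j]C[p∸j]≡nCp*pCj j≤p p≤n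
      indices : n ℕ.∸ j ℕ.∸ (p ℕ.∸ j) ≡ n ℕ.∸ p
      indices = P.trans (ℕP.∸-+-assoc n j (p ℕ.∸ j)) (P.cong (n ℕ.∸_) (ℕP.m+[n∸m]≡n j≤p))

    expand : ∀ p → p ≤ n →
      ιℕ (n C p) * (f ⋆ g) p * h (n ℕ.∸ p) ≈ sumTo p (λ j → T j (p ℕ.∸ j))
    expand p p≤n = begin
      ιℕ (n C p) * (f ⋆ g) p * h (n ℕ.∸ p)
        ≈⟨ *-congʳ (sumTo-*ˡ p _ _) ⟨
      sumTo p (λ j → ιℕ (n C p) * (ιℕ (p C j) * f j * g (p ℕ.∸ j))) * h (n ℕ.∸ p)
        ≈⟨ sumTo-*ʳ p _ _ ⟨
      sumTo p (λ j → ιℕ (n C p) * (ιℕ (p C j) * f j * g (p ℕ.∸ j)) * h (n ℕ.∸ p))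
        ≈⟨ sumTo-cong p (λ j j≤p → regroup j≤p p≤n) ⟩
      sumTo p (λ j → T j (p ℕ.∸ j)) ∎

module LucasBalancing {a ℓ} (R : CommutativeRing a ℓ) (x : CommutativeRing.Carrier R) where
  open CommutativeRing R hiding (zero)
  open InRing R
  open Cast R
  open Sums R
  open Convolution R
  open ℤ-Solver using (solve; Polynomial; con; _:=_; _:+_; _:*_; _:-_)
  open import Relation.Binary.Reasoning.Setoid setoid


  c d : Carrier
  c = ι (+ 18) * x * x - 1#
  d = ι (+ 36) * x * x * (ι (+ 9) * x * x - 1#)

  cₚ dₚ : ∀ {k} → Polynomial k → Polynomial k
  cₚ y = con (+ 18) :* y :* y :- con (+ 1)
  dₚ y = con (+ 36) :* y :* y :* (con (+ 9) :* y :* y :- con (+ 1))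

  -- (√d)^a = w a + v a · √d
  w v : ℕ → Carrier
  w zero = 1#
  w (suc zero) = 0#
  w (suc (suc a)) = d * w a
  v zero = 0#
  v (suc zero) = 1#
  v (suc (suc a)) = d * v a

  w-suc : ∀ a → w (suc a) ≈ d * v a
  w-suc zero = sym (zeroʳ d)
  w-suc (suc zero) = refl
  w-suc (suc (suc a)) = *-congˡ (w-suc a)

  v-suc : ∀ a → v (suc a) ≈ w a
  v-suc zero = refl
  v-suc (suc zero) = zeroʳ d
  v-suc (suc (suc a)) = *-congˡ (v-suc a)

  w-odd : ∀ k → w (suc (2 ℕ.* k)) ≈ 0#
  w-odd zero = refl
  w-odd (suc k) = trans (reflexive (P.cong (w ∘ suc) (ℕP.*-suc 2 k))) (trans (*-congˡ (w-odd k)) (zeroʳ d))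

  w-even : ∀ k → w (2 ℕ.* k) ≈ pow d k
  w-even zero = refl
  w-even (suc k) = trans (reflexive (P.cong w (ℕP.*-suc 2 k))) (*-congˡ (w-even k))

  w-* : ∀ a b → w a * w b ≈ w (a ℕ.+ b) * ι (isEven a)
  w-* zero b = trans (*-identityˡ _) (sym (trans (*-congˡ (+-identityʳ 1#)) (*-identityʳ _)))
  w-* (suc zero) b = trans (zeroˡ _) (sym (zeroʳ _))
  w-* (suc (suc a)) b = trans (*-assoc d (w a) (w b)) (trans (*-congˡ (w-* a b)) (sym (*-assoc _ _ _)))

  A B : ℕ → Carrier
  A = w ⋆ pow c
  B = v ⋆ pow c

  A-zero : A 0 ≈ 1#
  A-zero = trans (⋆-headˡ w (pow c) 0) (*-identityˡ 1#)

  B-zero : B 0 ≈ 0#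
  B-zero = trans (⋆-headˡ v (pow c) 0) (zeroˡ 1#)

  A-suc : ∀ m → A (suc m) ≈ c * A m + d * B m
  A-suc m = begin
    A (suc m)                                         ≈⟨ ⋆-suc w (pow c) m ⟩
    ((w ∘ suc) ⋆ pow c) m + (w ⋆ (λ k → c * pow c k)) m
      ≈⟨ +-cong (trans (⋆-congˡ (pow c) w-suc m) (⋆-*ˡ d v (pow c) m)) (⋆-*ʳ c w (pow c) m) ⟩
    d * B m + c * A m                                 ≈⟨ +-comm _ _ ⟩
    c * A m + d * B m                                 ∎

  B-suc : ∀ m → B (suc m) ≈ A m + c * B m
  B-suc m = trans (⋆-suc v (pow c) m) (+-cong (⋆-congˡ (pow c) v-suc m) (⋆-*ʳ c v (pow c) m))

  -- Holds because c² − d = 1.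
  A-recurrence : ∀ m → A (suc (suc m)) ≈ (c + c) * A (suc m) - A m
  A-recurrence m = begin
    A (suc (suc m))                          ≈⟨ trans (A-suc (suc m)) (+-cong (*-congˡ (A-suc m)) (*-congˡ (B-suc m))) ⟩
    c * (c * A m + d * B m) + d * (A m + c * B m)
      ≈⟨ solve 3 (λ y a b → cₚ y :* (cₚ y :* a :+ dₚ y :* b) :+ dₚ y :* (a :+ cₚ y :* b)
                            := (cₚ y :+ cₚ y) :* (cₚ y :* a :+ dₚ y :* b) :- a) refl x (A m) (B m) ⟩
    (c + c) * (c * A m + d * B m) - A m       ≈⟨ +-congʳ (*-congˡ (A-suc m)) ⟨
    (c + c) * A (suc m) - A m                 ∎

  Cpol-recurrence : ∀ n → Cpol (suc (suc (suc (suc n)))) x ≈ (c + c) * Cpol (suc (suc n)) x - Cpol n x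
  Cpol-recurrence n = solve 3 (λ y p₀ p₁ →
      let p₂ = con (+ 6) :* y :* p₁ :- p₀
          p₃ = con (+ 6) :* y :* p₂ :- p₁
      in con (+ 6) :* y :* p₃ :- p₂ := (cₚ y :+ cₚ y) :* p₂ :- p₀) refl x (Cpol n x) (Cpol (suc n) x)

  Cpol-even : ∀ m → Cpol (2 ℕ.* m) x ≈ A m
  Cpol-even m = proj₁ (consecutive m)
    where
    consecutive : ∀ m → Cpol (2 ℕ.* m) x ≈ A m × Cpol (2 ℕ.* suc m) x ≈ A (suc m)
    consecutive zero = sym A-zero , (begin
      ι (+ 6) * x * (ι (+ 3) * x) - 1#
        ≈⟨ solve 1 (λ y → con (+ 6) :* y :* (con (+ 3) :* y) :- con (+ 1)
                           := cₚ y :* con (+ 1) :+ dₚ y :* con (+ 0)) refl x ⟩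
      c * 1# + d * 0#   ≈⟨ +-cong (*-congˡ A-zero) (*-congˡ B-zero) ⟨
      c * A 0 + d * B 0 ≈⟨ A-suc 0 ⟨
      A 1               ∎)
    consecutive (suc m) = proj₂ ih , (begin
      Cpol (2 ℕ.* suc (suc m)) x
        ≡⟨ P.cong (λ k → Cpol k x) (P.trans (ℕP.*-suc 2 (suc m)) (P.cong (2 ℕ.+_) (ℕP.*-suc 2 m))) ⟩
      Cpol (4 ℕ.+ 2 ℕ.* m) x
        ≈⟨ Cpol-recurrence (2 ℕ.* m) ⟩
      (c + c) * Cpol (2 ℕ.+ 2 ℕ.* m) x - Cpol (2 ℕ.* m) x
        ≈⟨ +-cong (*-congˡ (trans (reflexive (P.cong (λ k → Cpol k x) (P.sym (ℕP.*-suc 2 m)))) (proj₂ ih)))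
                  (-‿cong (proj₁ ih)) ⟩
      (c + c) * A (suc m) - A m
        ≈⟨ A-recurrence m ⟨
      A (suc (suc m)) ∎)
      where ih = consecutive m

  wE : ℕ → Carrier
  wE j = w j * ι (E j)

  wE⋆w : ∀ p → (wE ⋆ w) p ≈ w p * ι (isZero p)
  wE⋆w p = begin
    (wE ⋆ w) p                                ≈⟨ sumTo-cong p (λ j j≤p → summand j≤p) ⟩
    sumTo p (λ j → w p * ι (eulerTerm p j))   ≈⟨ sumTo-*ˡ p _ _ ⟩
    w p * sumTo p (ι ∘ eulerTerm p)           ≈⟨ *-congˡ (ι-sumTo p _) ⟨
    w p * ι (∑ℤ p (eulerTerm p))              ≡⟨ P.cong (λ i → w p * ι i) (euler-recurrence p) ⟩
    w p * ι (isZero p)                        ∎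
    where
    summand : ∀ {j} → j ≤ p → ιℕ (p C j) * wE j * w (p ℕ.∸ j) ≈ w p * ι (eulerTerm p j)
    summand {j} j≤p = begin
      ιℕ (p C j) * (w j * ι (E j)) * w (p ℕ.∸ j)
        ≈⟨ solve 4 (λ b u e u′ → b :* (u :* e) :* u′ := u′ :* u :* (b :* e)) refl _ _ _ _ ⟩
      w (p ℕ.∸ j) * w j * (ιℕ (p C j) * ι (E j))
        ≈⟨ *-congʳ (w-* (p ℕ.∸ j) j) ⟩
      w (p ℕ.∸ j ℕ.+ j) * ι (isEven (p ℕ.∸ j)) * (ιℕ (p C j) * ι (E j))
        ≡⟨ P.cong (λ i → w i * ι (isEven (p ℕ.∸ j)) * (ιℕ (p C j) * ι (E j))) (ℕP.m∸n+n≡m j≤p) ⟩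
      w p * ι (isEven (p ℕ.∸ j)) * (ιℕ (p C j) * ι (E j))
        ≈⟨ solve 4 (λ u i b e → u :* i :* (b :* e) := u :* (b :* i :* e)) refl _ _ _ _ ⟩
      w p * (ιℕ (p C j) * ι (isEven (p ℕ.∸ j)) * ι (E j))
        ≈⟨ *-congˡ (trans (ι-* (coshWeight p j) (E j)) (*-congʳ (ι-* (+ (p C j)) (isEven (p ℕ.∸ j))))) ⟨
      w p * ι (eulerTerm p j) ∎

  lhs≈wE⋆A : ∀ n → lhs n x ≈ (wE ⋆ A) n
  lhs≈wE⋆A n = trans (sumTo-cong (n ℕ./ 2) (λ k _ → summand k)) (sumTo-evens F F-odd n)
    where
    F : ℕ → Carrier
    F j = ιℕ (n C j) * wE j * A (n ℕ.∸ j)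

    F-odd : ∀ k → F (suc (2 ℕ.* k)) ≈ 0#
    F-odd k = trans (*-congʳ (trans (*-congˡ (trans (*-congʳ (w-odd k)) (zeroˡ _))) (zeroʳ _))) (zeroˡ _)

    summand : ∀ k → ιℕ (n C (2 ℕ.* k)) * Cpol (2 ℕ.* (n ℕ.∸ 2 ℕ.* k)) x * pow d k * ι (E (2 ℕ.* k)) ≈ F (2 ℕ.* k)
    summand k = trans (solve 4 (λ b q u e → b :* q :* u :* e := b :* (u :* e) :* q) refl _ _ _ _)
                      (*-cong (*-congˡ (*-congʳ (sym (w-even k)))) (Cpol-even (n ℕ.∸ 2 ℕ.* k)))

theorem3 : {c ℓ : Level} (R : CommutativeRing c ℓ) (n : ℕ) (x : CommutativeRing.Carrier R) →
    CommutativeRing._≈_ R (InRing.lhs R n x) (InRing.rhs R n x)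
theorem3 R n x = begin
  lhs n x                 ≈⟨ lhs≈wE⋆A n ⟩
  (wE ⋆ (w ⋆ pow c)) n    ≈⟨ ⋆-assoc wE w (pow c) n ⟨
  ((wE ⋆ w) ⋆ pow c) n    ≈⟨ ⋆-concentratedˡ (wE ⋆ w) (pow c) (λ j → trans (wE⋆w (suc j)) (zeroʳ _)) n ⟩
  (wE ⋆ w) 0 * pow c n    ≈⟨ *-congʳ (trans (wE⋆w 0) (trans (*-identityˡ _) (+-identityʳ 1#))) ⟩
  1# * pow c n            ≈⟨ *-identityˡ _ ⟩
  rhs n x                 ∎
  where
  open CommutativeRing R hiding (zero)
  open InRing R
  open Convolution R
  open LucasBalancing R x
  open import Relation.Binary.Reasoning.Setoid setoid
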